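{- Let $G$ be a partial cube and let $\{F_1,\ldots,F_k\}$ be a partition of $E(G)$ that is coarser than the $\Theta$-partition of $E(G)$. Then for each $i\in\{1,\ldots,k\}$ the quotient graph $G/F_i$ is a partial cube.
   Context: All graphs are finite, simple and connected; $d_G(u,v)$ denotes the shortest-path distance in $G$. The hypercube $Q_n$ has vertex set $\{0,1\}^n$, two tuples being adjacent iff they differ in exactly one coordinate. A subgraph $H$ of $G$ is isometric if $d_H(u,v)=d_G(u,v)$ for all $u,v\in V(H)$; a partial cube is a graph isomorphic to an isometric subgraph of some hypercube. Two edges $u_1v_1$ and $u_2v_2$ of $G$ are in relation $\Theta$ if $d_G(u_1,u_2)+d_G(v_1,v_2)\neq d_G(u_1,v_2)+d_G(v_1,u_2)$. In a partial cube, $\Theta$ is an equivalence relation on $E(G)$; its classes are called $\Theta$-classes and they form the $\Theta$-partition. A partition $\{F_1,\ldots,F_k\}$ of $E(G)$ is coarser than the $\Theta$-partition if every $F_i$ is a union of one or more $\Theta$-classes. For $F\subseteq E(G)$, the quotient graph $G/F$ has as vertices the vertex sets of the connected components of $G-F$ (the graph with vertex set $V(G)$ and edge set $E(G)\setminus F$), and two distinct such components are adjacent iff some vertex of one is adjacent in $G$ to some vertex of the other. -}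

module Defs where

open import Data.Nat using (ℕ; zero; suc; _+_; _≤_)
open import Data.Fin using (Fin)
open import Data.Bool using (Bool; true; false; _xor_)
open import Data.Vec using (Vec; []; _∷_)
open import Data.Product using (Σ; ∃; ∃-syntax; _×_; _,_)
open import Relation.Binary.PropositionalEquality using (_≡_; _≢_)
open import Relation.Nullary using (¬_)
open import Function.Bundles using (_⇔_)

record Graph : Set₁ where
  field
    n      : ℕ
    Adj    : Fin n → Fin n → Set
    sym    : ∀ {u v} → Adj u v → Adj v u
    irrefl : ∀ {u} → ¬ Adj u u
open Graph public

data Walk {n : ℕ} (R : Fin n → Fin n → Set) : Fin n → Fin n → ℕ → Set where
  here : ∀ {u} → Walk R u u 0
  step : ∀ {u w v ℓ} → R u w → Walk R w v ℓ → Walk R u v (suc ℓ)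

Connected : Graph → Set
Connected G = ∀ u v → ∃[ ℓ ] Walk (Adj G) u v ℓ

Dist : (G : Graph) → Fin (n G) → Fin (n G) → ℕ → Set
Dist G u v d = Walk (Adj G) u v d × (∀ ℓ → Walk (Adj G) u v ℓ → d ≤ ℓ)

-- Hypercube Q_N : vertices Vec Bool N, adjacent iff Hamming distance 1.
-- d_{Q_N} is the Hamming distance.

hamming : ∀ {N} → Vec Bool N → Vec Bool N → ℕ
hamming []       []       = 0
hamming (x ∷ xs) (y ∷ ys) with x xor y
... | true  = suc (hamming xs ys)
... | false = hamming xs ys

-- G is a partial cube: G is isomorphic (via the injective map f, whose
-- image subgraph H has the images of G's edges as edges) to a subgraph
-- H of Q_N whose edges are edges of Q_N, and H is isometric in Q_N,
-- i.e. d_G(u,v) = d_H(f u, f v) = d_{Q_N}(f u, f v).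
PartialCube : Graph → Set
PartialCube G =
  ∃[ N ] Σ (Fin (n G) → Vec Bool N) λ f →
      (∀ u v → f u ≡ f v → u ≡ v)
    × (∀ u v → Adj G u v → hamming (f u) (f v) ≡ 1)
    × (∀ u v → Dist G u v (hamming (f u) (f v)))

Θ : (G : Graph) → (u₁ v₁ u₂ v₂ : Fin (n G)) → Set
Θ G u₁ v₁ u₂ v₂ =
  Adj G u₁ v₁ × Adj G u₂ v₂ ×
  ∃[ a ] ∃[ b ] ∃[ c ] ∃[ d ]
    Dist G u₁ u₂ a × Dist G v₁ v₂ b × Dist G u₁ v₂ c × Dist G v₁ u₂ d ×
    (a + b ≢ c + d)

-- A partition {F_1,…,F_k} of E(G) is given by a labelling of edges
-- lab : the edge uv lies in the block F_(lab u v). It must be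
-- well defined on unordered edges, and every block is nonempty.

IsEdgePartition : (G : Graph) (k : ℕ) → (Fin (n G) → Fin (n G) → Fin k) → Set
IsEdgePartition G k lab =
    (∀ u v → Adj G u v → lab u v ≡ lab v u)
  × (∀ (i : Fin k) → ∃[ u ] ∃[ v ] (Adj G u v × lab u v ≡ i))

CoarserThanΘ : (G : Graph) {k : ℕ} → (Fin (n G) → Fin (n G) → Fin k) → Set
CoarserThanΘ G lab =
  ∀ u₁ v₁ u₂ v₂ → Θ G u₁ v₁ u₂ v₂ → lab u₁ v₁ ≡ lab u₂ v₂

-- Its vertices (components of G − F) are represented by Fin m via a
-- surjective map c sending each vertex to its component, with
-- c u ≡ c v iff u and v are joined by a walk in G − F.

AdjMinus : (G : Graph) → (Fin (n G) → Fin (n G) → Set) → Fin (n G) → Fin (n G) → Set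
AdjMinus G F u v = Adj G u v × ¬ F u v

IsComponentMap : (G : Graph) → (Fin (n G) → Fin (n G) → Set) →
                 (m : ℕ) → (Fin (n G) → Fin m) → Set
IsComponentMap G F m c =
    (∀ (a : Fin m) → ∃[ u ] c u ≡ a)
  × (∀ u v → (c u ≡ c v) ⇔ (∃[ ℓ ] Walk (AdjMinus G F) u v ℓ))

Quotient : (G : Graph) (m : ℕ) → (Fin (n G) → Fin m) → Graph
Quotient G m c = record
  { n      = m
  ; Adj    = λ a b → a ≢ b × ∃[ u ] ∃[ v ] (c u ≡ a × c v ≡ b × Adj G u v)
  ; sym    = λ { (a≢b , u , v , cu , cv , e) →
                 (λ p → a≢b (Relation.Binary.PropositionalEquality.sym p))
                 , v , u , cv , cu , Graph.sym G e }
  ; irrefl = λ { (a≢a , _) → a≢a Relation.Binary.PropositionalEquality.refl }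
  }

module Submission where

-- Fix an isometric embedding f : G → Q_N.  Every edge
-- of G flips exactly one coordinate of f, and two edges flipping the same
-- coordinate are in relation Θ.  Hence, if an edge set F is closed under Θ
-- (as every block of a partition coarser than the Θ-partition is), the
-- coordinates split into the mask M of coordinates flipped by F-edges and
-- the complementary coordinates, flipped by the remaining edges only.  The
-- restriction of f to M is constant on the components of G − F, so it
-- induces a map g on the quotient G/F that sends edges to edges.  Along a
-- walk of G the F-edges move the M-part and the other edges move the
-- complementary part, one coordinate each; applied to a geodesic of G this
-- yields a walk of G/F whose length is exactly the Hamming distance under
-- g, so g is an isometric embedding.

open import Defs hiding (sym)
open import Data.Nat using (ℕ; suc; pred; _+_; _≤_; _<_; z≤n; s≤s)
open import Data.Nat.Properties using (≤-refl; ≤-reflexive; ≤-trans; ≤-antisym; +-suc; n≤1+n; n<1+n; +-mono-≤; +-mono-<; +-cancelʳ-≤; <⇒≢; >⇒≢; 0≢1+n)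
open import Data.Fin using (Fin; zero; suc)
open import Data.Fin.Properties using (any?; _≟_)
open import Data.Bool using (Bool; true; false; not; _∧_)
import Data.Bool.Properties as Boolₚ
open import Data.Vec using (Vec; []; _∷_; lookup; tabulate; map; zipWith; updateAt)
open import Data.Vec.Properties using (≡-dec; lookup∘tabulate; lookup-map)
open import Data.Product using (∃; ∃₂; _×_; _,_; proj₁; proj₂)
open import Data.Sum using (_⊎_; inj₁; inj₂)
open import Data.Empty using (⊥-elim)
open import Relation.Nullary using (¬_; Dec; yes; no; does)
open import Relation.Nullary.Decidable using (_×-dec_; dec-true; dec-false)
open import Relation.Binary.Definitions using (Decidable)
open import Function.Bundles using (Equivalence)
open import Relation.Binary.PropositionalEquality using (_≡_; _≢_; refl; sym; trans; cong; subst; subst₂)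

sum-squeeze : ∀ {p q a b : ℕ} → p + q ≡ a + b → a ≤ p → b ≤ q → p ≡ a
sum-squeeze {p} {q} {a} e a≤p b≤q =
  ≤-antisym (+-cancelʳ-≤ q p a (subst (_≤ a + q) (sym e) (+-mono-≤ (≤-refl {a}) b≤q))) a≤p

walk-length-0 : ∀ {n} {R : Fin n → Fin n → Set} {u v} → Walk R u v 0 → u ≡ v
walk-length-0 here = refl

walk-length-1 : ∀ {n} {R : Fin n → Fin n → Set} {u v} → Walk R u v 1 → R u v
walk-length-1 (step r here) = r

hamming-self : ∀ {N} (x : Vec Bool N) → hamming x x ≡ 0
hamming-self []          = refl
hamming-self (true ∷ x)  = hamming-self x
hamming-self (false ∷ x) = hamming-self x

≡⇒hamming-0 : ∀ {N} {x y : Vec Bool N} → x ≡ y → hamming x y ≡ 0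
≡⇒hamming-0 {x = x} refl = hamming-self x

hamming-0⇒≡ : ∀ {N} (x y : Vec Bool N) → hamming x y ≡ 0 → x ≡ y
hamming-0⇒≡ []          []          _  = refl
hamming-0⇒≡ (true ∷ x)  (true ∷ y)  d0 = cong (true ∷_) (hamming-0⇒≡ x y d0)
hamming-0⇒≡ (false ∷ x) (false ∷ y) d0 = cong (false ∷_) (hamming-0⇒≡ x y d0)
hamming-0⇒≡ (true ∷ x)  (false ∷ y) ()
hamming-0⇒≡ (false ∷ x) (true ∷ y)  ()

hamming-triangle : ∀ {N} (x y z : Vec Bool N) → hamming x z ≤ hamming x y + hamming y z
hamming-triangle []          []          []          = z≤n
hamming-triangle (true ∷ x)  (true ∷ y)  (true ∷ z)  = hamming-triangle x y z
hamming-triangle (false ∷ x) (false ∷ y) (false ∷ z) = hamming-triangle x y z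
hamming-triangle (true ∷ x)  (false ∷ y) (false ∷ z) = s≤s (hamming-triangle x y z)
hamming-triangle (false ∷ x) (true ∷ y)  (true ∷ z)  = s≤s (hamming-triangle x y z)
hamming-triangle (true ∷ x)  (true ∷ y)  (false ∷ z) =
  ≤-trans (s≤s (hamming-triangle x y z)) (≤-reflexive (sym (+-suc _ _)))
hamming-triangle (false ∷ x) (false ∷ y) (true ∷ z)  =
  ≤-trans (s≤s (hamming-triangle x y z)) (≤-reflexive (sym (+-suc _ _)))
hamming-triangle (true ∷ x)  (false ∷ y) (true ∷ z)  =
  ≤-trans (hamming-triangle x y z) (+-mono-≤ (n≤1+n _) (n≤1+n _))
hamming-triangle (false ∷ x) (true ∷ y)  (false ∷ z) =
  ≤-trans (hamming-triangle x y z) (+-mono-≤ (n≤1+n _) (n≤1+n _))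

hamming-compose : ∀ {N} (x y z : Vec Bool N) {a b : ℕ} →
  hamming x y ≤ a → hamming y z ≤ b → hamming x z ≤ a + b
hamming-compose x y z xy≤a yz≤b = ≤-trans (hamming-triangle x y z) (+-mono-≤ xy≤a yz≤b)

flipAt : ∀ {N} → Fin N → Vec Bool N → Vec Bool N
flipAt j x = updateAt x j not

flipAt-hamming-1 : ∀ {N} (j : Fin N) (x : Vec Bool N) → hamming x (flipAt j x) ≡ 1
flipAt-hamming-1 zero    (true ∷ x)  = cong suc (hamming-self x)
flipAt-hamming-1 zero    (false ∷ x) = cong suc (hamming-self x)
flipAt-hamming-1 (suc j) (true ∷ x)  = flipAt-hamming-1 j x
flipAt-hamming-1 (suc j) (false ∷ x) = flipAt-hamming-1 j x

hamming-1⇒flipAt : ∀ {N} (x y : Vec Bool N) → hamming x y ≡ 1 → ∃ λ j → y ≡ flipAt j x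
hamming-1⇒flipAt []          []          ()
hamming-1⇒flipAt (true ∷ x)  (false ∷ y) d1 = zero , cong (false ∷_) (sym (hamming-0⇒≡ x y (cong pred d1)))
hamming-1⇒flipAt (false ∷ x) (true ∷ y)  d1 = zero , cong (true ∷_) (sym (hamming-0⇒≡ x y (cong pred d1)))
hamming-1⇒flipAt (true ∷ x)  (true ∷ y)  d1 with hamming-1⇒flipAt x y d1
... | j , y≡ = suc j , cong (true ∷_) y≡
hamming-1⇒flipAt (false ∷ x) (false ∷ y) d1 with hamming-1⇒flipAt x y d1
... | j , y≡ = suc j , cong (false ∷_) y≡

hamming-flipAt-both : ∀ {N} (j : Fin N) (x y : Vec Bool N) →
  hamming (flipAt j x) (flipAt j y) ≡ hamming x y
hamming-flipAt-both zero    (true ∷ x)  (true ∷ y)  = refl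
hamming-flipAt-both zero    (true ∷ x)  (false ∷ y) = refl
hamming-flipAt-both zero    (false ∷ x) (true ∷ y)  = refl
hamming-flipAt-both zero    (false ∷ x) (false ∷ y) = refl
hamming-flipAt-both (suc j) (true ∷ x)  (true ∷ y)  = hamming-flipAt-both j x y
hamming-flipAt-both (suc j) (true ∷ x)  (false ∷ y) = cong suc (hamming-flipAt-both j x y)
hamming-flipAt-both (suc j) (false ∷ x) (true ∷ y)  = cong suc (hamming-flipAt-both j x y)
hamming-flipAt-both (suc j) (false ∷ x) (false ∷ y) = hamming-flipAt-both j x y

hamming-flipAt-swap : ∀ {N} (j : Fin N) (x y : Vec Bool N) →
  hamming (flipAt j x) y ≡ hamming x (flipAt j y)
hamming-flipAt-swap zero    (true ∷ x)  (true ∷ y)  = refl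
hamming-flipAt-swap zero    (true ∷ x)  (false ∷ y) = refl
hamming-flipAt-swap zero    (false ∷ x) (true ∷ y)  = refl
hamming-flipAt-swap zero    (false ∷ x) (false ∷ y) = refl
hamming-flipAt-swap (suc j) (true ∷ x)  (true ∷ y)  = hamming-flipAt-swap j x y
hamming-flipAt-swap (suc j) (true ∷ x)  (false ∷ y) = cong suc (hamming-flipAt-swap j x y)
hamming-flipAt-swap (suc j) (false ∷ x) (true ∷ y)  = cong suc (hamming-flipAt-swap j x y)
hamming-flipAt-swap (suc j) (false ∷ x) (false ∷ y) = hamming-flipAt-swap j x y

hamming-flipAt-changes : ∀ {N} (j : Fin N) (x y : Vec Bool N) →
  hamming x y < hamming x (flipAt j y) ⊎ hamming x (flipAt j y) < hamming x y
hamming-flipAt-changes zero    (true ∷ x)  (true ∷ y)  = inj₁ (n<1+n _)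
hamming-flipAt-changes zero    (true ∷ x)  (false ∷ y) = inj₂ (n<1+n _)
hamming-flipAt-changes zero    (false ∷ x) (true ∷ y)  = inj₂ (n<1+n _)
hamming-flipAt-changes zero    (false ∷ x) (false ∷ y) = inj₁ (n<1+n _)
hamming-flipAt-changes (suc j) (true ∷ x)  (true ∷ y)  = hamming-flipAt-changes j x y
hamming-flipAt-changes (suc j) (false ∷ x) (false ∷ y) = hamming-flipAt-changes j x y
hamming-flipAt-changes (suc j) (true ∷ x)  (false ∷ y) with hamming-flipAt-changes j x y
... | inj₁ lt = inj₁ (s≤s lt)
... | inj₂ gt = inj₂ (s≤s gt)
hamming-flipAt-changes (suc j) (false ∷ x) (true ∷ y)  with hamming-flipAt-changes j x y
... | inj₁ lt = inj₁ (s≤s lt)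
... | inj₂ gt = inj₂ (s≤s gt)

-- Two hypercube edges across the same coordinate are in relation Θ:
-- with a = d(x,u) = d(x',u') and c = d(x,u') = d(x',u), a ≠ c forces a + a ≠ c + c.
flipAt-Θ : ∀ {N} (j : Fin N) (x u : Vec Bool N) →
  hamming x u + hamming (flipAt j x) (flipAt j u) ≢ hamming x (flipAt j u) + hamming (flipAt j x) u
flipAt-Θ j x u rewrite hamming-flipAt-both j x u | hamming-flipAt-swap j x u
  with hamming-flipAt-changes j x u
... | inj₁ lt = <⇒≢ (+-mono-< lt lt)
... | inj₂ gt = >⇒≢ (+-mono-< gt gt)

restrict : ∀ {N} → Vec Bool N → Vec Bool N → Vec Bool N
restrict M x = zipWith _∧_ M x

hamming-split : ∀ {N} (M x y : Vec Bool N) →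
  hamming x y ≡ hamming (restrict M x) (restrict M y) + hamming (restrict (map not M) x) (restrict (map not M) y)
hamming-split []          []          []          = refl
hamming-split (true ∷ M)  (true ∷ x)  (true ∷ y)  = hamming-split M x y
hamming-split (true ∷ M)  (true ∷ x)  (false ∷ y) = cong suc (hamming-split M x y)
hamming-split (true ∷ M)  (false ∷ x) (true ∷ y)  = cong suc (hamming-split M x y)
hamming-split (true ∷ M)  (false ∷ x) (false ∷ y) = hamming-split M x y
hamming-split (false ∷ M) (true ∷ x)  (true ∷ y)  = hamming-split M x y
hamming-split (false ∷ M) (true ∷ x)  (false ∷ y) = trans (cong suc (hamming-split M x y)) (sym (+-suc _ _))
hamming-split (false ∷ M) (false ∷ x) (true ∷ y)  = trans (cong suc (hamming-split M x y)) (sym (+-suc _ _))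
hamming-split (false ∷ M) (false ∷ x) (false ∷ y) = hamming-split M x y

restrict-flipAt-outside : ∀ {N} (j : Fin N) (M x : Vec Bool N) →
  lookup M j ≡ false → restrict M (flipAt j x) ≡ restrict M x
restrict-flipAt-outside zero    (false ∷ M) (b ∷ x) _   = refl
restrict-flipAt-outside (suc j) (m ∷ M)     (b ∷ x) j∉M = cong ((m ∧ b) ∷_) (restrict-flipAt-outside j M x j∉M)

restrict-flipAt-inside : ∀ {N} (j : Fin N) (M x : Vec Bool N) →
  lookup M j ≡ true → hamming (restrict M x) (restrict M (flipAt j x)) ≡ 1
restrict-flipAt-inside zero    (true ∷ M)  (true ∷ x)  _   = cong suc (hamming-self (restrict M x))
restrict-flipAt-inside zero    (true ∷ M)  (false ∷ x) _   = cong suc (hamming-self (restrict M x))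
restrict-flipAt-inside (suc j) (true ∷ M)  (true ∷ x)  j∈M = restrict-flipAt-inside j M x j∈M
restrict-flipAt-inside (suc j) (true ∷ M)  (false ∷ x) j∈M = restrict-flipAt-inside j M x j∈M
restrict-flipAt-inside (suc j) (false ∷ M) (b ∷ x)     j∈M = restrict-flipAt-inside j M x j∈M

walk-hamming-bound : ∀ {n N} {R : Fin n → Fin n → Set} (φ : Fin n → Vec Bool N) →
  (∀ {u v} → R u v → hamming (φ u) (φ v) ≤ 1) →
  ∀ {u v ℓ} → Walk R u v ℓ → hamming (φ u) (φ v) ≤ ℓ
walk-hamming-bound φ step-bound {u} here = ≤-reflexive (hamming-self (φ u))
walk-hamming-bound φ step-bound {u} {v} (step {w = w} r walk) =
  hamming-compose (φ u) (φ w) (φ v) (step-bound r) (walk-hamming-bound φ step-bound walk)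

partialCube-criterion : (H : Graph) {N : ℕ} (φ : Fin (n H) → Vec Bool N) →
  (∀ u v → Adj H u v → hamming (φ u) (φ v) ≡ 1) →
  (∀ u v → Walk (Adj H) u v (hamming (φ u) (φ v))) →
  PartialCube H
partialCube-criterion H {N} φ edge geodesic = N , φ , injective , edge , distance
  where
  injective : ∀ u v → φ u ≡ φ v → u ≡ v
  injective u v φu≡φv = walk-length-0 (subst (Walk (Adj H) u v) (≡⇒hamming-0 φu≡φv) (geodesic u v))

  distance : ∀ u v → Dist H u v (hamming (φ u) (φ v))
  distance u v = geodesic u v , λ ℓ walk → walk-hamming-bound φ (λ {u} {v} a → ≤-reflexive (edge u v a)) walk

module WalkSplitting {n m N N′ : ℕ} (R : Fin n → Fin n → Set) (S : Fin m → Fin m → Set)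
  (c : Fin n → Fin m) (φ : Fin n → Vec Bool N) (ψ : Fin n → Vec Bool N′) where

  Crossing : Fin n → Fin n → Set
  Crossing x w = S (c x) (c w) × hamming (φ x) (φ w) ≤ 1 × hamming (ψ x) (ψ w) ≤ 0

  Internal : Fin n → Fin n → Set
  Internal x w = c x ≡ c w × hamming (φ x) (φ w) ≤ 0 × hamming (ψ x) (ψ w) ≤ 1

  split-walk : (∀ {x w} → R x w → Crossing x w ⊎ Internal x w) →
    ∀ {x y ℓ} → Walk R x y ℓ →
    ∃₂ λ p q → p + q ≡ ℓ × Walk S (c x) (c y) p × hamming (φ x) (φ y) ≤ p × hamming (ψ x) (ψ y) ≤ q
  split-walk classify {x} here =
    0 , 0 , refl , here , ≤-reflexive (hamming-self (φ x)) , ≤-reflexive (hamming-self (ψ x))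
  split-walk classify {x} {y} (step {w = w} r walk) with classify r | split-walk classify walk
  ... | inj₁ (s , φ≤1 , ψ≤0) | p , q , refl , W , φ≤p , ψ≤q =
    suc p , q , refl , step s W ,
    hamming-compose (φ x) (φ w) (φ y) φ≤1 φ≤p , hamming-compose (ψ x) (ψ w) (ψ y) ψ≤0 ψ≤q
  ... | inj₂ (cx≡cw , φ≤0 , ψ≤1) | p , q , refl , W , φ≤p , ψ≤q =
    p , suc q , +-suc p q , subst (λ t → Walk S t (c y) p) (sym cx≡cw) W ,
    hamming-compose (φ x) (φ w) (φ y) φ≤0 φ≤p , hamming-compose (ψ x) (ψ w) (ψ y) ψ≤1 ψ≤q

module ΘClosedQuotient (G : Graph) {N : ℕ} (f : Fin (n G) → Vec Bool N)
  (f-edge : ∀ u v → Adj G u v → hamming (f u) (f v) ≡ 1)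
  (f-dist : ∀ u v → Dist G u v (hamming (f u) (f v)))
  (F : Fin (n G) → Fin (n G) → Set) (F? : Decidable F)
  (Θ-closed : ∀ x y u v → Θ G x y u v → F u v → F x y)
  (m : ℕ) (c : Fin (n G) → Fin m) (components : IsComponentMap G F m c) where

  Q : Graph
  Q = Quotient G m c

  adjacent-if-hamming-1 : ∀ u v → hamming (f u) (f v) ≡ 1 → Adj G u v
  adjacent-if-hamming-1 u v d≡1 = walk-length-1 (subst (Walk (Adj G) u v) d≡1 (proj₁ (f-dist u v)))

  flipAt-adjacent : ∀ {j u v} → f v ≡ flipAt j (f u) → Adj G u v
  flipAt-adjacent {j} {u} {v} fv≡ =
    adjacent-if-hamming-1 u v (subst (λ z → hamming (f u) z ≡ 1) (sym fv≡) (flipAt-hamming-1 j (f u)))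

  edge-coordinate : ∀ {x y} → Adj G x y → ∃ λ j → f y ≡ flipAt j (f x)
  edge-coordinate {x} {y} a = hamming-1⇒flipAt (f x) (f y) (f-edge x y a)

  parallel⇒Θ : ∀ j x y u v → Adj G x y → Adj G u v →
    f y ≡ flipAt j (f x) → f v ≡ flipAt j (f u) → Θ G x y u v
  parallel⇒Θ j x y u v axy auv fy≡ fv≡ =
    axy , auv , _ , _ , _ , _ , f-dist x u , f-dist y v , f-dist x v , f-dist y u , distances-differ
    where
    distances-differ : hamming (f x) (f u) + hamming (f y) (f v) ≢ hamming (f x) (f v) + hamming (f y) (f u)
    distances-differ rewrite fy≡ | fv≡ = flipAt-Θ j (f x) (f u)

  FlippedByF : Fin N → Set
  FlippedByF j = ∃₂ λ u v → f v ≡ flipAt j (f u) × F u v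

  flippedByF? : ∀ j → Dec (FlippedByF j)
  flippedByF? j = any? λ u → any? λ v → ≡-dec Boolₚ._≟_ (f v) (flipAt j (f u)) ×-dec F? u v

  M : Vec Bool N
  M = tabulate (λ j → does (flippedByF? j))

  mask-in : ∀ {j u v} → f v ≡ flipAt j (f u) → F u v → lookup M j ≡ true
  mask-in {j} {u} {v} fv≡ Fuv = trans (lookup∘tabulate _ j) (dec-true (flippedByF? j) (u , v , fv≡ , Fuv))

  -- A coordinate flipped by a non-F edge is not in M: by Θ-closedness any
  -- F-edge across the same coordinate would force the edge itself into F.
  mask-out : ∀ {j x y} → Adj G x y → f y ≡ flipAt j (f x) → ¬ F x y → lookup M j ≡ false
  mask-out {j} {x} {y} axy fy≡ ¬Fxy = trans (lookup∘tabulate _ j) (dec-false (flippedByF? j) no-F-edge)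
    where
    no-F-edge : ¬ FlippedByF j
    no-F-edge (u , v , fv≡ , Fuv) = ¬Fxy (Θ-closed x y u v θ Fuv)
      where
      θ : Θ G x y u v
      θ = parallel⇒Θ j x y u v axy (flipAt-adjacent fv≡) fy≡ fv≡

  inside : Fin (n G) → Vec Bool N
  inside x = restrict M (f x)

  outside : Fin (n G) → Vec Bool N
  outside x = restrict (map not M) (f x)

  F-edge-moves : ∀ {x y} → Adj G x y → F x y →
    hamming (inside x) (inside y) ≡ 1 × hamming (outside x) (outside y) ≡ 0
  F-edge-moves {x} {y} a Fxy with edge-coordinate a
  ... | j , fy≡ =
    subst (λ z → hamming (inside x) (restrict M z) ≡ 1) (sym fy≡) (restrict-flipAt-inside j M (f x) j∈M) ,
    subst (λ z → hamming (outside x) (restrict (map not M) z) ≡ 0) (sym fy≡)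
      (≡⇒hamming-0 (sym (restrict-flipAt-outside j (map not M) (f x) j∉notM)))
    where
    j∈M : lookup M j ≡ true
    j∈M = mask-in fy≡ Fxy
    j∉notM : lookup (map not M) j ≡ false
    j∉notM = trans (lookup-map j not M) (cong not j∈M)

  nonF-edge-moves : ∀ {x y} → Adj G x y → ¬ F x y →
    inside x ≡ inside y × hamming (outside x) (outside y) ≡ 1
  nonF-edge-moves {x} {y} a ¬Fxy with edge-coordinate a
  ... | j , fy≡ =
    subst (λ z → inside x ≡ restrict M z) (sym fy≡) (sym (restrict-flipAt-outside j M (f x) j∉M)) ,
    subst (λ z → hamming (outside x) (restrict (map not M) z) ≡ 1) (sym fy≡) (restrict-flipAt-inside j (map not M) (f x) j∈notM)
    where
    j∉M : lookup M j ≡ false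
    j∉M = mask-out a fy≡ ¬Fxy
    j∈notM : lookup (map not M) j ≡ true
    j∈notM = trans (lookup-map j not M) (cong not j∉M)

  same-component⇒same-inside : ∀ {u v} → c u ≡ c v → inside u ≡ inside v
  same-component⇒same-inside {u} {v} cu≡cv = along (proj₂ (Equivalence.to (proj₂ components u v) cu≡cv))
    where
    along : ∀ {x y ℓ} → Walk (AdjMinus G F) x y ℓ → inside x ≡ inside y
    along here                = refl
    along (step (a , ¬F) walk) = trans (proj₁ (nonF-edge-moves a ¬F)) (along walk)

  nonF-edge⇒same-component : ∀ {x y} → Adj G x y → ¬ F x y → c x ≡ c y
  nonF-edge⇒same-component {x} {y} a ¬Fxy = Equivalence.from (proj₂ components x y) (1 , step (a , ¬Fxy) here)

  -- An F-edge joins different components, since it moves the inside part.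
  F-edge⇒different-components : ∀ {x y} → Adj G x y → F x y → c x ≢ c y
  F-edge⇒different-components a Fxy cx≡cy =
    0≢1+n (trans (sym (≡⇒hamming-0 (same-component⇒same-inside cx≡cy))) (proj₁ (F-edge-moves a Fxy)))

  open WalkSplitting (Adj G) (Adj Q) c inside outside

  classify : ∀ {x w} → Adj G x w → Crossing x w ⊎ Internal x w
  classify {x} {w} a with F? x w
  ... | yes Fxw = inj₁ ((F-edge⇒different-components a Fxw , x , w , refl , refl , a) ,
                        ≤-reflexive (proj₁ (F-edge-moves a Fxw)) , ≤-reflexive (proj₂ (F-edge-moves a Fxw)))
  ... | no ¬Fxw = inj₂ (nonF-edge⇒same-component a ¬Fxw ,
                        ≤-reflexive (≡⇒hamming-0 (proj₁ (nonF-edge-moves a ¬Fxw))) ,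
                        ≤-reflexive (proj₂ (nonF-edge-moves a ¬Fxw)))

  representative : Fin m → Fin (n G)
  representative a = proj₁ (proj₁ components a)

  representative-component : ∀ a → c (representative a) ≡ a
  representative-component a = proj₂ (proj₁ components a)

  g : Fin m → Vec Bool N
  g a = inside (representative a)

  g-respects : ∀ u → g (c u) ≡ inside u
  g-respects u = same-component⇒same-inside (representative-component (c u))

  -- Edges of G/F come from F-edges, so g maps them to hypercube edges.
  g-edge : ∀ a b → Adj Q a b → hamming (g a) (g b) ≡ 1
  g-edge _ _ (a≢b , x , y , refl , refl , axy) with F? x y
  ... | yes Fxy = subst₂ (λ s t → hamming s t ≡ 1) (sym (g-respects x)) (sym (g-respects y)) (proj₁ (F-edge-moves axy Fxy))
  ... | no ¬Fxy = ⊥-elim (a≢b (nonF-edge⇒same-component axy ¬Fxy))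

  -- A geodesic of G from x to y projects to a walk of G/F of length equal to
  -- the inside distance: total = inside + outside squeezes both bounds.
  projected-geodesic : ∀ x y → Walk (Adj Q) (c x) (c y) (hamming (inside x) (inside y))
  projected-geodesic x y with split-walk classify (proj₁ (f-dist x y))
  ... | p , q , p+q≡d , walk , inside≤p , outside≤q = subst (Walk (Adj Q) (c x) (c y)) p≡d walk
    where
    p≡d : p ≡ hamming (inside x) (inside y)
    p≡d = sum-squeeze (trans p+q≡d (hamming-split M (f x) (f y))) inside≤p outside≤q

  g-geodesic : ∀ a b → Walk (Adj Q) a b (hamming (g a) (g b))
  g-geodesic a b =
    subst₂ (λ s t → Walk (Adj Q) s t (hamming (g a) (g b)))
      (representative-component a) (representative-component b)
      (projected-geodesic (representative a) (representative b))

  quotient-partialCube : PartialCube Q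
  quotient-partialCube = partialCube-criterion Q g g-edge g-geodesic

Θ-closed-quotient-partialCube : (G : Graph) → PartialCube G →
  (F : Fin (n G) → Fin (n G) → Set) → Decidable F →
  (∀ x y u v → Θ G x y u v → F u v → F x y) →
  (m : ℕ) (c : Fin (n G) → Fin m) → IsComponentMap G F m c →
  PartialCube (Quotient G m c)
Θ-closed-quotient-partialCube G (_ , f , _ , f-edge , f-dist) F F? Θ-closed m c components =
  ΘClosedQuotient.quotient-partialCube G f f-edge f-dist F F? Θ-closed m c components

lemma3p2 : (G : Graph) → Connected G → PartialCube G →
           (k : ℕ) (lab : Fin (n G) → Fin (n G) → Fin k) →
           IsEdgePartition G k lab → CoarserThanΘ G lab →
           (i : Fin k) (m : ℕ) (c : Fin (n G) → Fin m) →
           IsComponentMap G (λ u v → lab u v ≡ i) m c →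
           PartialCube (Quotient G m c)
lemma3p2 G _ pc k lab _ coarse i m c components =
  Θ-closed-quotient-partialCube G pc (λ u v → lab u v ≡ i) (λ u v → lab u v ≟ i)
    (λ x y u v θ labuv≡i → trans (coarse x y u v θ) labuv≡i) m c components
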